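{- For every modal tree $\mathtt{T}$, $\mathscr{T}(\mathscr{F}(\mathtt{T}))=\mathtt{T}$; and for every strictly positive formula $\varphi$, $\mathscr{F}(\mathscr{T}(\varphi))\vdash_{\mathbf{K}^+}\varphi$ and $\varphi\vdash_{\mathbf{K}^+}\mathscr{F}(\mathscr{T}(\varphi))$.
   Context: Strictly positive formulas $\mathcal{L}^+$: $\varphi::=\top\mid p\mid\langle\alpha\rangle\varphi\mid(\varphi\wedge\varphi)$ with $p$ a propositional variable and $\alpha<\omega$. $\mathbf{K}^+$ is the sequent system with axioms $\varphi\vdash\varphi$, $\varphi\vdash\top$, $\varphi\wedge\psi\vdash\varphi$, $\varphi\wedge\psi\vdash\psi$, and rules: from $\varphi\vdash\psi$ and $\psi\vdash\chi$ infer $\varphi\vdash\chi$; from $\varphi\vdash\psi$ and $\varphi\vdash\chi$ infer $\varphi\vdash\psi\wedge\chi$; from $\varphi\vdash\psi$ infer $\langle\alpha\rangle\varphi\vdash\langle\alpha\rangle\psi$. Modal trees: recursively, pairs $\langle\Delta;\Gamma\rangle$ with $\Delta$ a finite list of propositional variables and $\Gamma$ a finite list of pairs $(\alpha,\mathtt{S})$, $\alpha<\omega$, $\mathtt{S}$ a modal tree (equality is equality of these nested lists). Sum: $\langle\Delta_1;\Gamma_1\rangle+\langle\Delta_2;\Gamma_2\rangle=\langle\Delta_1\frown\Delta_2;\Gamma_1\frown\Gamma_2\rangle$. $\mathscr{T}(\top)=\langle\varnothing;\varnothing\rangle$, $\mathscr{T}(p)=\langle[p];\varnothing\rangle$, $\mathscr{T}(\langle\alpha\rangle\varphi)=\langle\varnothing;[(\alpha,\mathscr{T}(\varphi))]\rangle$,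 $\mathscr{T}(\varphi\wedge\psi)=\mathscr{T}(\varphi)+\mathscr{T}(\psi)$. For a finite list $\Pi$ of formulas, $\bigwedge\varnothing=\top$, $\bigwedge(\varphi\frown\Pi)=\varphi\wedge\bigwedge\Pi$. $\mathscr{F}(\langle\Delta;\Gamma\rangle):=\bigwedge\Delta\wedge\bigwedge[\langle\alpha\rangle\mathscr{F}(\mathtt{S})\mid(\alpha,\mathtt{S})\in\Gamma]$. -}

module Defs where

open import Data.Nat using (ℕ)
open import Data.List using (List; []; _∷_; _++_; map)
open import Data.Product using (_×_; _,_)

Var : Set
Var = ℕ

data Fm : Set where
  ⊤'   : Fm
  var  : Var → Fm
  ⟨_⟩_ : ℕ → Fm → Fm
  _∧_  : Fm → Fm → Fm

infixr 6 _∧_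
infix 2 _⊢_

data _⊢_ : Fm → Fm → Set where
  ax    : ∀ {φ} → φ ⊢ φ
  top   : ∀ {φ} → φ ⊢ ⊤'
  ∧-e₁  : ∀ {φ ψ} → φ ∧ ψ ⊢ φ
  ∧-e₂  : ∀ {φ ψ} → φ ∧ ψ ⊢ ψ
  cut   : ∀ {φ ψ χ} → φ ⊢ ψ → ψ ⊢ χ → φ ⊢ χ
  ∧-i   : ∀ {φ ψ χ} → φ ⊢ ψ → φ ⊢ χ → φ ⊢ ψ ∧ χ
  nec   : ∀ {α φ ψ} → φ ⊢ ψ → ⟨ α ⟩ φ ⊢ ⟨ α ⟩ ψ

data Tree : Set where
  ⟨_⨾_⟩ : List Var → List (ℕ × Tree) → Tree

_⊕_ : Tree → Tree → Tree
⟨ Δ₁ ⨾ Γ₁ ⟩ ⊕ ⟨ Δ₂ ⨾ Γ₂ ⟩ = ⟨ Δ₁ ++ Δ₂ ⨾ Γ₁ ++ Γ₂ ⟩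

𝓣 : Fm → Tree
𝓣 ⊤' = ⟨ [] ⨾ [] ⟩
𝓣 (var p) = ⟨ p ∷ [] ⨾ [] ⟩
𝓣 (⟨ α ⟩ φ) = ⟨ [] ⨾ (α , 𝓣 φ) ∷ [] ⟩
𝓣 (φ ∧ ψ) = 𝓣 φ ⊕ 𝓣 ψ

⋀ : List Fm → Fm
⋀ [] = ⊤'
⋀ (φ ∷ Π) = φ ∧ ⋀ Π

mutual
  𝓕 : Tree → Fm
  𝓕 ⟨ Δ ⨾ Γ ⟩ = ⋀ (map var Δ) ∧ ⋀ (diamonds Γ)

  -- diamonds Γ = map (λ (α , S) → ⟨ α ⟩ 𝓕 S) Γ, written out for termination
  diamonds : List (ℕ × Tree) → List Fm
  diamonds [] = []
  diamonds ((α , S) ∷ Γ) = (⟨ α ⟩ 𝓕 S) ∷ diamonds Γ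

{-# OPTIONS --safe #-}
-- 𝓣 sends ∧ to ⊕ (concatenation) and ⊤' to the empty tree, the unit of ⊕, so 𝓣 ∘ 𝓕 is the
-- identity on the nose. 𝓕 ∘ 𝓣 only re-brackets and re-orders conjunctions and inserts copies
-- of ⊤', which K⁺ undoes because, up to interderivability, ∧ is associative with unit ⊤' and
-- satisfies interchange.
module Submission where

open import Defs
open import Data.Nat using (ℕ)
open import Data.List using (List; []; _∷_; _++_; map)
open import Data.List.Properties using (++-identityʳ; map-++)
open import Data.Product using (_×_; _,_; swap)
open import Level using (0ℓ)
open import Relation.Binary.Bundles using (Setoid)
open import Relation.Binary.Structures using (IsEquivalence)
open import Relation.Binary.PropositionalEquality using (_≡_; refl; cong)

𝓣-⋀-var : (Δ : List Var) → 𝓣 (⋀ (map var Δ)) ≡ ⟨ Δ ⨾ [] ⟩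
𝓣-⋀-var []      = refl
𝓣-⋀-var (p ∷ Δ) = cong (⟨ p ∷ [] ⨾ [] ⟩ ⊕_) (𝓣-⋀-var Δ)

𝓣-𝓕         : (T : Tree) → 𝓣 (𝓕 T) ≡ T
𝓣-⋀-diamonds : (Γ : List (ℕ × Tree)) → 𝓣 (⋀ (diamonds Γ)) ≡ ⟨ [] ⨾ Γ ⟩

𝓣-𝓕 ⟨ Δ ⨾ Γ ⟩
  rewrite 𝓣-⋀-var Δ | 𝓣-⋀-diamonds Γ = cong ⟨_⨾ Γ ⟩ (++-identityʳ Δ)

𝓣-⋀-diamonds []            = refl
𝓣-⋀-diamonds ((α , S) ∷ Γ)
  rewrite 𝓣-𝓕 S | 𝓣-⋀-diamonds Γ = refl

infix 2 _⊣⊢_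

_⊣⊢_ : Fm → Fm → Set
φ ⊣⊢ ψ = (φ ⊢ ψ) × (ψ ⊢ φ)

⊣⊢-isEquivalence : IsEquivalence _⊣⊢_
⊣⊢-isEquivalence = record
  { refl  = ax , ax
  ; sym   = swap
  ; trans = λ (f , g) (f′ , g′) → cut f f′ , cut g′ g
  }

⊣⊢-setoid : Setoid 0ℓ 0ℓ
⊣⊢-setoid = record { isEquivalence = ⊣⊢-isEquivalence }

open Setoid ⊣⊢-setoid using () renaming (refl to ⊣⊢-refl; sym to ⊣⊢-sym)
open import Relation.Binary.Reasoning.Setoid ⊣⊢-setoid

∧-mono : ∀ {φ φ′ ψ ψ′} → φ ⊢ φ′ → ψ ⊢ ψ′ → φ ∧ ψ ⊢ φ′ ∧ ψ′
∧-mono f g = ∧-i (cut ∧-e₁ f) (cut ∧-e₂ g)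

∧-cong : ∀ {φ φ′ ψ ψ′} → φ ⊣⊢ φ′ → ψ ⊣⊢ ψ′ → φ ∧ ψ ⊣⊢ φ′ ∧ ψ′
∧-cong (f , g) (f′ , g′) = ∧-mono f f′ , ∧-mono g g′

⟨⟩-cong : ∀ {α φ ψ} → φ ⊣⊢ ψ → ⟨ α ⟩ φ ⊣⊢ ⟨ α ⟩ ψ
⟨⟩-cong (f , g) = nec f , nec g

∧-identityˡ : ∀ φ → ⊤' ∧ φ ⊣⊢ φ
∧-identityˡ φ = ∧-e₂ , ∧-i top ax

∧-identityʳ : ∀ φ → φ ∧ ⊤' ⊣⊢ φ
∧-identityʳ φ = ∧-e₁ , ∧-i ax top

∧-assoc : ∀ φ ψ χ → (φ ∧ ψ) ∧ χ ⊣⊢ φ ∧ (ψ ∧ χ)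
∧-assoc φ ψ χ = ∧-i (cut ∧-e₁ ∧-e₁) (∧-mono ∧-e₂ ax)
              , ∧-i (∧-mono ax ∧-e₁) (cut ∧-e₂ ∧-e₂)

∧-interchange : ∀ φ ψ χ ω → (φ ∧ ψ) ∧ (χ ∧ ω) ⊣⊢ (φ ∧ χ) ∧ (ψ ∧ ω)
∧-interchange φ ψ χ ω = interchange , interchange
  where
  interchange : ∀ {a b c d} → (a ∧ b) ∧ (c ∧ d) ⊢ (a ∧ c) ∧ (b ∧ d)
  interchange = ∧-i (∧-mono ∧-e₁ ∧-e₁) (∧-mono ∧-e₂ ∧-e₂)

⋀-++ : (Π Σ : List Fm) → ⋀ (Π ++ Σ) ⊣⊢ ⋀ Π ∧ ⋀ Σ
⋀-++ []      Σ = ⊣⊢-sym (∧-identityˡ (⋀ Σ))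
⋀-++ (φ ∷ Π) Σ = begin
  φ ∧ ⋀ (Π ++ Σ)     ≈⟨ ∧-cong ⊣⊢-refl (⋀-++ Π Σ) ⟩
  φ ∧ (⋀ Π ∧ ⋀ Σ)    ≈⟨ ∧-assoc φ (⋀ Π) (⋀ Σ) ⟨
  (φ ∧ ⋀ Π) ∧ ⋀ Σ    ∎

diamonds-++ : (Γ₁ Γ₂ : List (ℕ × Tree)) → diamonds (Γ₁ ++ Γ₂) ≡ diamonds Γ₁ ++ diamonds Γ₂
diamonds-++ []       Γ₂ = refl
diamonds-++ (β ∷ Γ₁) Γ₂ = cong (_ ∷_) (diamonds-++ Γ₁ Γ₂)

𝓕-⊕ : (S T : Tree) → 𝓕 (S ⊕ T) ⊣⊢ 𝓕 S ∧ 𝓕 T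
𝓕-⊕ ⟨ Δ₁ ⨾ Γ₁ ⟩ ⟨ Δ₂ ⨾ Γ₂ ⟩ rewrite map-++ var Δ₁ Δ₂ | diamonds-++ Γ₁ Γ₂ = begin
  ⋀ (vs₁ ++ vs₂) ∧ ⋀ (ds₁ ++ ds₂)         ≈⟨ ∧-cong (⋀-++ vs₁ vs₂) (⋀-++ ds₁ ds₂) ⟩
  (⋀ vs₁ ∧ ⋀ vs₂) ∧ (⋀ ds₁ ∧ ⋀ ds₂)       ≈⟨ ∧-interchange (⋀ vs₁) (⋀ vs₂) (⋀ ds₁) (⋀ ds₂) ⟩
  (⋀ vs₁ ∧ ⋀ ds₁) ∧ (⋀ vs₂ ∧ ⋀ ds₂)       ∎
  where
  vs₁ vs₂ ds₁ ds₂ : List Fm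
  vs₁ = map var Δ₁
  vs₂ = map var Δ₂
  ds₁ = diamonds Γ₁
  ds₂ = diamonds Γ₂

𝓕-𝓣 : (φ : Fm) → 𝓕 (𝓣 φ) ⊣⊢ φ
𝓕-𝓣 ⊤'        = ∧-identityʳ ⊤'
𝓕-𝓣 (var p)   = begin
  (var p ∧ ⊤') ∧ ⊤'          ≈⟨ ∧-identityʳ (var p ∧ ⊤') ⟩
  var p ∧ ⊤'                 ≈⟨ ∧-identityʳ (var p) ⟩
  var p                      ∎
𝓕-𝓣 (⟨ α ⟩ φ) = begin
  ⊤' ∧ (⟨ α ⟩ 𝓕 (𝓣 φ) ∧ ⊤')  ≈⟨ ∧-identityˡ _ ⟩
  ⟨ α ⟩ 𝓕 (𝓣 φ) ∧ ⊤'         ≈⟨ ∧-identityʳ _ ⟩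
  ⟨ α ⟩ 𝓕 (𝓣 φ)              ≈⟨ ⟨⟩-cong (𝓕-𝓣 φ) ⟩
  ⟨ α ⟩ φ                    ∎
𝓕-𝓣 (φ ∧ ψ)   = begin
  𝓕 (𝓣 φ ⊕ 𝓣 ψ)              ≈⟨ 𝓕-⊕ (𝓣 φ) (𝓣 ψ) ⟩
  𝓕 (𝓣 φ) ∧ 𝓕 (𝓣 ψ)          ≈⟨ ∧-cong (𝓕-𝓣 φ) (𝓕-𝓣 ψ) ⟩
  φ ∧ ψ                      ∎

mainTheorem4 : ((T : Tree) → 𝓣 (𝓕 T) ≡ T)
    × ((φ : Fm) → (𝓕 (𝓣 φ) ⊢ φ) × (φ ⊢ 𝓕 (𝓣 φ)))
mainTheorem4 = 𝓣-𝓕 , 𝓕-𝓣
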